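{- For all integers $s \ge 1$ and $t \ge 2$, a linear extension of $EN_{s,t}$ avoids $2143$ if and only if, for every $j$ with $3 \le j \le s$, the entry $jt$ appears before the entry $(j-3)t+1$.
   Context: For positive integers $s,t$, write each $x \in [st]=\{1,\dots,st\}$ uniquely as $x=(j-1)t+r$ with $1\le j\le s$ and $1\le r\le t$. The poset $EN_{s,t}$ is $[st]$ with the partial order $(j-1)t+r \preceq (j'-1)t+r'$ if and only if $j'\le j$ and $r\le r'$. A linear extension of a poset $([n],\preceq)$ is a permutation $\pi=\pi(1)\cdots\pi(n)$ of $[n]$ (one-line notation) such that whenever $a\preceq b$ and $a\ne b$, $a$ appears before $b$ in $\pi$. A permutation $\pi$ avoids $\sigma$ if it has no subsequence with the same relative order as $\sigma$. -}

module Defs where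

open import Data.Nat using (ℕ; zero; suc; _+_; _*_; _∸_; _≤_; _<_)
open import Data.Fin using (Fin) renaming (_<_ to _<ᶠ_)
open import Data.List using (List; length; lookup; applyUpTo)
open import Data.List.Relation.Binary.Permutation.Propositional using (_↭_)
open import Data.Product using (_×_; ∃-syntax)
open import Relation.Binary.PropositionalEquality using (_≡_; _≢_)
open import Relation.Nullary using (¬_)

IsPerm : ℕ → List ℕ → Set
IsPerm n π = π ↭ applyUpTo suc n

Before : List ℕ → ℕ → ℕ → Set
Before π a b = ∃[ i ] ∃[ k ] (i <ᶠ k × lookup π i ≡ a × lookup π k ≡ b)

-- The order of EN_{s,t}.  With 0-based j,r: x = j*t + (r+1), 0 ≤ j < s, 0 ≤ r < t,
-- i.e. x = (J-1)t + R with J = j+1, R = r+1 as in the paper.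
-- (J-1)t+R ⪯ (J'-1)t+R'  iff  J' ≤ J and R ≤ R'.
ENLeq : ℕ → ℕ → ℕ → ℕ → Set
ENLeq s t x y =
  ∃[ j ] ∃[ r ] ∃[ j' ] ∃[ r' ]
    ( j < s × r < t × j' < s × r' < t
    × x ≡ j * t + suc r × y ≡ j' * t + suc r'
    × j' ≤ j × r ≤ r' )

IsLinExtEN : ℕ → ℕ → List ℕ → Set
IsLinExtEN s t π =
  IsPerm (s * t) π × (∀ a b → ENLeq s t a b → a ≢ b → Before π a b)

Contains2143 : List ℕ → Set
Contains2143 π =
  ∃[ i₁ ] ∃[ i₂ ] ∃[ i₃ ] ∃[ i₄ ]
    ( i₁ <ᶠ i₂ × i₂ <ᶠ i₃ × i₃ <ᶠ i₄
    × lookup π i₂ < lookup π i₁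
    × lookup π i₁ < lookup π i₄
    × lookup π i₄ < lookup π i₃ )

Avoids2143 : List ℕ → Set
Avoids2143 π = ¬ Contains2143 π

-- Number the blocks of EN_{s,t} from 0, so that block j holds j*t+1, …, j*t+t; the
-- condition says that the top of every block j ≥ 2 precedes the bottom of block j-2.
-- In a linear extension an inversion (a larger entry before a smaller one) must go
-- down at least one block.  A copy b a d c of 2143 has inversions b a and d c and
-- b < c, so the block of d is at least two above that of a; then the bottom of the
-- block two below d's precedes a, which precedes d, which precedes the top of d's
-- block, against the condition.  Conversely, if the bottom of block j came before
-- the top of block j+2, then the bottoms of blocks j+1 and j and the tops of blocks
-- j+2 and j+1 would form a 2143.
module Submission where

open import Defs
open import Data.Nat
  using (ℕ; suc; _+_; _*_; _∸_; _≤_; _<_; z≤n; s≤s; z<s; NonZero; pred; >-nonZero; >-nonZero⁻¹; _≟_)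
open import Data.Nat.Properties
open import Data.Nat.DivMod using (_/_; _%_; m≡m%n+[m/n]*n; m%n<n; m<n*o⇒m/o<n)
open import Data.Fin using (Fin) renaming (_<_ to _<ᶠ_; zero to fzero; suc to fsuc)
import Data.Fin.Properties as Fin
open import Data.List using (List; _∷_; length; lookup; applyUpTo)
import Data.List.Relation.Unary.All as All
open import Data.List.Relation.Unary.AllPairs using (_∷_)
open import Data.List.Relation.Unary.Any using (index)
open import Data.List.Relation.Unary.Any.Properties using (lookup-index)
open import Data.List.Relation.Unary.Unique.Propositional using (Unique)
open import Data.List.Relation.Unary.Unique.Propositional.Properties using (applyUpTo⁺₁)
open import Data.List.Membership.Propositional using (_∈_)
open import Data.List.Membership.Propositional.Properties using (∈-lookup; ∈-applyUpTo⁺; ∈-applyUpTo⁻)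
open import Data.List.Relation.Binary.Permutation.Propositional using (↭-sym; ↭⇒↭ₛ)
open import Data.List.Relation.Binary.Permutation.Propositional.Properties using (∈-resp-↭)
open import Data.Product using (_,_)
open import Data.Sum using (_⊎_; inj₁; inj₂)
open import Data.Empty using (⊥; ⊥-elim)
open import Relation.Nullary using (yes; no)
open import Relation.Binary using (tri<; tri≈; tri>)
open import Relation.Binary.Construct.Closure.Reflexive using (ReflClosure; refl; [_])
open import Relation.Binary.PropositionalEquality
  using (_≡_; _≢_; refl; sym; trans; cong; subst; subst₂; setoid)
open import Function.Base using (_∘_)
open import Function.Bundles using (_⇔_; mk⇔)
import Function.Properties.Equivalence as Equivalence
open import Data.List.Relation.Binary.Permutation.Setoid.Properties (setoid ℕ) using (Unique-resp-↭)

lookup-injective : ∀ {A : Set} {xs : List A} → Unique xs →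
  (i k : Fin (length xs)) → lookup xs i ≡ lookup xs k → i ≡ k
lookup-injective {xs = _ ∷ _} _          fzero    fzero    _ = refl
lookup-injective {xs = _ ∷ _} (x∉ ∷ _)   fzero    (fsuc k) e = ⊥-elim (All.lookup x∉ (∈-lookup k) e)
lookup-injective {xs = _ ∷ _} (x∉ ∷ _)   (fsuc i) fzero    e = ⊥-elim (All.lookup x∉ (∈-lookup i) (sym e))
lookup-injective {xs = _ ∷ _} (_ ∷ xs!)  (fsuc i) (fsuc k) e = cong fsuc (lookup-injective xs! i k e)

applyUpTo-suc-unique : ∀ n → Unique (applyUpTo suc n)
applyUpTo-suc-unique n = applyUpTo⁺₁ suc n (λ i<j _ e → <-irrefl (suc-injective e) i<j)

module _ {π : List ℕ} (π! : Unique π) where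

  Before-trans : ∀ {a b c} → Before π a b → Before π b c → Before π a c
  Before-trans (i , k , i<k , a≡ , b≡) (k' , l , k'<l , b≡' , c≡)
    with lookup-injective π! k k' (trans b≡ (sym b≡'))
  ... | refl = i , l , Fin.<-trans i<k k'<l , a≡ , c≡

  Before-asym : ∀ {a b} → Before π a b → Before π b a → ⊥
  Before-asym a<b b<a with Before-trans a<b b<a
  ... | i , k , i<k , a≡ , a≡' with lookup-injective π! i k (trans a≡ (sym a≡'))
  ...   | refl = Fin.<-irrefl refl i<k

  Before-total : ∀ {a b} → a ∈ π → b ∈ π → a ≢ b → Before π a b ⊎ Before π b a
  Before-total a∈π b∈π a≢b with Fin.<-cmp (index a∈π) (index b∈π)
  ... | tri< i<k _ _ = inj₁ (index a∈π , index b∈π , i<k , sym (lookup-index a∈π) , sym (lookup-index b∈π))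
  ... | tri≈ _ i≡k _ =
    ⊥-elim (a≢b (trans (lookup-index a∈π) (trans (cong (lookup π) i≡k) (sym (lookup-index b∈π)))))
  ... | tri> _ _ k<i = inj₂ (index b∈π , index a∈π , k<i , sym (lookup-index b∈π) , sym (lookup-index a∈π))

  Before-via : ∀ {a b c d} → ReflClosure (Before π) a b → Before π b c → ReflClosure (Before π) c d →
    Before π a d
  Before-via refl    b<c refl    = b<c
  Before-via refl    b<c [ c<d ] = Before-trans b<c c<d
  Before-via [ a<b ] b<c refl    = Before-trans a<b b<c
  Before-via [ a<b ] b<c [ c<d ] = Before-trans (Before-trans a<b b<c) c<d

  Before³⇒Contains2143 : ∀ {x₁ x₂ x₃ x₄} → Before π x₁ x₂ → Before π x₂ x₃ → Before π x₃ x₄ →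
    x₂ < x₁ → x₁ < x₄ → x₄ < x₃ → Contains2143 π
  Before³⇒Contains2143 (i₁ , i₂ , i₁<i₂ , x₁≡ , x₂≡) (i₂' , i₃ , i₂'<i₃ , x₂≡' , x₃≡)
    (i₃' , i₄ , i₃'<i₄ , x₃≡' , x₄≡) x₂<x₁ x₁<x₄ x₄<x₃
    with lookup-injective π! i₂ i₂' (trans x₂≡ (sym x₂≡'))
       | lookup-injective π! i₃ i₃' (trans x₃≡ (sym x₃≡'))
  ... | refl | refl =
    i₁ , i₂ , i₃ , i₄ , i₁<i₂ , i₂'<i₃ , i₃'<i₄ ,
    subst₂ _<_ (sym x₂≡) (sym x₁≡) x₂<x₁ ,
    subst₂ _<_ (sym x₁≡) (sym x₄≡) x₁<x₄ ,
    subst₂ _<_ (sym x₄≡) (sym x₃≡) x₄<x₃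

cell : ℕ → ℕ → ℕ → ℕ
cell t j r = j * t + suc r

cell-top : ∀ t .{{_ : NonZero t}} j → cell t j (pred t) ≡ suc j * t
cell-top t j = trans (cong (j * t +_) (suc-pred t)) (+-comm (j * t) t)

record Cell (s t x : ℕ) : Set where
  field
    block    : ℕ
    offset   : ℕ
    block<s  : block < s
    offset<t : offset < t
    value    : x ≡ cell t block offset

open Cell

module _ {s t x y : ℕ} (cx : Cell s t x) (cy : Cell s t y) where

  Cell-<-block : block cx < block cy → x < y
  Cell-<-block bx<by = begin-strict
    x                              ≡⟨ value cx ⟩
    block cx * t + suc (offset cx) ≤⟨ +-monoʳ-≤ (block cx * t) (offset<t cx) ⟩
    block cx * t + t               ≡⟨ +-comm (block cx * t) t ⟩
    suc (block cx) * t             ≤⟨ *-monoˡ-≤ t bx<by ⟩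
    block cy * t                   <⟨ m<m+n (block cy * t) z<s ⟩
    block cy * t + suc (offset cy) ≡⟨ value cy ⟨
    y                              ∎
    where open ≤-Reasoning

  Cell-<-offset : block cx ≡ block cy → offset cx < offset cy → x < y
  Cell-<-offset bx≡by ox<oy = begin-strict
    x                              ≡⟨ value cx ⟩
    block cx * t + suc (offset cx) <⟨ +-monoʳ-< (block cx * t) (s≤s ox<oy) ⟩
    block cx * t + suc (offset cy) ≡⟨ cong (λ b → b * t + suc (offset cy)) bx≡by ⟩
    block cy * t + suc (offset cy) ≡⟨ value cy ⟨
    y                              ∎
    where open ≤-Reasoning

Cell-≤⇒block-≤ : ∀ {s t x y} → x ≤ y → (cx : Cell s t x) (cy : Cell s t y) → block cx ≤ block cy
Cell-≤⇒block-≤ x≤y cx cy = ≮⇒≥ (λ by<bx → <⇒≱ (Cell-<-block cy cx by<bx) x≤y)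

Cell⇒ENLeq : ∀ {s t x y} (cx : Cell s t x) (cy : Cell s t y) →
  block cy ≤ block cx → offset cx ≤ offset cy → ENLeq s t x y
Cell⇒ENLeq cx cy cy≤cx cx≤cy = block cx , offset cx , block cy , offset cy ,
  block<s cx , offset<t cx , block<s cy , offset<t cy , value cx , value cy , cy≤cx , cx≤cy

module _ {s t : ℕ} .{{_ : NonZero t}} where

  bottom-cell : ∀ {j} → j < s → Cell s t (cell t j 0)
  bottom-cell j<s = record
    { block<s = j<s ; offset<t = >-nonZero⁻¹ t ; value = refl }

  top-cell : ∀ {j} → j < s → Cell s t (cell t j (pred t))
  top-cell j<s = record
    { block<s = j<s ; offset<t = ≤-reflexive (suc-pred t) ; value = refl }

  upTo⇒Cell : ∀ {x} → x ∈ applyUpTo suc (s * t) → Cell s t x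
  upTo⇒Cell x∈ with ∈-applyUpTo⁻ suc x∈
  ... | m , m<st , x≡ = record
    { block<s  = m<n*o⇒m/o<n m<st
    ; offset<t = m%n<n m t
    ; value    = trans x≡ (trans (cong suc (m≡m%n+[m/n]*n m t)) (+-comm (suc (m % t)) (m / t * t)))
    }

  Cell⇒upTo : ∀ {x} → Cell s t x → x ∈ applyUpTo suc (s * t)
  Cell⇒upTo c = subst (_∈ applyUpTo suc (s * t)) (sym (trans (value c) (+-suc _ (offset c))))
    (∈-applyUpTo⁺ suc (begin-strict
      block c * t + offset c       <⟨ +-monoʳ-< (block c * t) (offset<t c) ⟩
      block c * t + t              ≡⟨ +-comm (block c * t) t ⟩
      suc (block c) * t            ≤⟨ *-monoˡ-≤ t (block<s c) ⟩
      s * t                        ∎))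
    where open ≤-Reasoning

module LinearExtension {s t : ℕ} .{{_ : NonZero t}} {π : List ℕ} (perm : IsPerm (s * t) π)
  (ext : ∀ a b → ENLeq s t a b → a ≢ b → Before π a b) where

  π! : Unique π
  π! = Unique-resp-↭ (↭⇒↭ₛ (↭-sym perm)) (applyUpTo-suc-unique (s * t))

  cell-of : ∀ {x} → x ∈ π → Cell s t x
  cell-of = upTo⇒Cell ∘ ∈-resp-↭ perm

  Cell⇒∈ : ∀ {x} → Cell s t x → x ∈ π
  Cell⇒∈ = ∈-resp-↭ (↭-sym perm) ∘ Cell⇒upTo

  ENLeq⇒Before⁼ : ∀ {x y} → ENLeq s t x y → ReflClosure (Before π) x y
  ENLeq⇒Before⁼ {x} {y} x⪯y with x ≟ y
  ... | yes refl = refl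
  ... | no x≢y   = [ ext x y x⪯y x≢y ]

  inversion-lowers-block : ∀ {x y} → Before π x y → y < x → (cx : Cell s t x) (cy : Cell s t y) →
    block cy < block cx
  inversion-lowers-block x<y y<x cx cy = ≤∧≢⇒< (Cell-≤⇒block-≤ (<⇒≤ y<x) cy cx) same-block⇒⊥
    where
    same-block⇒⊥ : block cy ≢ block cx
    same-block⇒⊥ e = Before-asym π! x<y (ext _ _
      (Cell⇒ENLeq cy cx (≤-reflexive (sym e))
        (≮⇒≥ (λ ox<oy → <-asym y<x (Cell-<-offset cx cy (sym e) ox<oy))))
      (<⇒≢ y<x))

  TopBeforeBottom : Set
  TopBeforeBottom = ∀ j → 2 ≤ j → j < s → Before π (cell t j (pred t)) (cell t (j ∸ 2) 0)

  TopBeforeBottom⇒Avoids2143 : TopBeforeBottom → Avoids2143 π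
  TopBeforeBottom⇒Avoids2143 tbb
    (i₁ , i₂ , i₃ , i₄ , i₁<i₂ , i₂<i₃ , i₃<i₄ , x₂<x₁ , x₁<x₄ , x₄<x₃) =
    Before-asym π! (tbb (block c₃) 2≤b₃ (block<s c₃)) bottom-before-top
    where
    before : ∀ {i k} → i <ᶠ k → Before π (lookup π i) (lookup π k)
    before {i} {k} i<k = i , k , i<k , refl , refl
    c₁ = cell-of (∈-lookup i₁)
    c₂ = cell-of (∈-lookup i₂)
    c₃ = cell-of (∈-lookup i₃)
    c₄ = cell-of (∈-lookup i₄)
    gap : 2 + block c₂ ≤ block c₃
    gap = ≤-trans (s≤s (≤-trans (inversion-lowers-block (before i₁<i₂) x₂<x₁ c₁ c₂)
                                (Cell-≤⇒block-≤ (<⇒≤ x₁<x₄) c₁ c₄)))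
                  (inversion-lowers-block (before i₃<i₄) x₄<x₃ c₃ c₄)
    2≤b₃ : 2 ≤ block c₃
    2≤b₃ = ≤-trans (s≤s (s≤s z≤n)) gap
    bottom-before-top : Before π (cell t (block c₃ ∸ 2) 0) (cell t (block c₃) (pred t))
    bottom-before-top = Before-via π!
      (ENLeq⇒Before⁼ (Cell⇒ENLeq (bottom-cell (≤-<-trans (m∸n≤m _ 2) (block<s c₃))) c₂
        (∸-monoˡ-≤ 2 gap) z≤n))
      (before i₂<i₃)
      (ENLeq⇒Before⁼ (Cell⇒ENLeq c₃ (top-cell (block<s c₃)) ≤-refl (<⇒≤pred (offset<t c₃))))

  bottom-before-top⇒Contains2143 : 2 ≤ t → ∀ {j} → 2 + j < s →
    Before π (cell t j 0) (cell t (2 + j) (pred t)) → Contains2143 π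
  bottom-before-top⇒Contains2143 2≤t {j} j+2<s bottom-first =
    Before³⇒Contains2143 π! B₁-before-B₀ bottom-first T₂-before-T₁ B₀<B₁ B₁<T₁ T₁<T₂
    where
    j+1<s = ≤-trans (n≤1+n _) j+2<s
    j<s   = ≤-trans (n≤1+n _) j+1<s
    B₀ = bottom-cell j<s
    B₁ = bottom-cell j+1<s
    T₁ = top-cell j+1<s
    T₂ = top-cell j+2<s
    B₀<B₁ : cell t j 0 < cell t (suc j) 0
    B₀<B₁ = Cell-<-block B₀ B₁ (n<1+n j)
    B₁<T₁ : cell t (suc j) 0 < cell t (suc j) (pred t)
    B₁<T₁ = Cell-<-offset B₁ T₁ refl (pred-mono-≤ 2≤t)
    T₁<T₂ : cell t (suc j) (pred t) < cell t (2 + j) (pred t)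
    T₁<T₂ = Cell-<-block T₁ T₂ (n<1+n (suc j))
    B₁-before-B₀ = ext _ _ (Cell⇒ENLeq B₁ B₀ (n≤1+n j) z≤n) (>⇒≢ B₀<B₁)
    T₂-before-T₁ = ext _ _ (Cell⇒ENLeq T₂ T₁ (n≤1+n _) ≤-refl) (>⇒≢ T₁<T₂)

  Avoids2143⇒TopBeforeBottom : 2 ≤ t → Avoids2143 π → TopBeforeBottom
  Avoids2143⇒TopBeforeBottom 2≤t avoids (suc (suc j)) (s≤s (s≤s z≤n)) j+2<s
    with Before-total π! (Cell⇒∈ (top-cell j+2<s)) (Cell⇒∈ (bottom-cell j<s)) top≢bottom
    where
    j<s : j < s
    j<s = ≤-trans (m≤n+m _ 2) j+2<s
    top≢bottom : cell t (2 + j) (pred t) ≢ cell t j 0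
    top≢bottom = >⇒≢ (Cell-<-block (bottom-cell j<s) (top-cell j+2<s) (m<n⇒m<1+n (n<1+n j)))
  ... | inj₁ top-first    = top-first
  ... | inj₂ bottom-first = ⊥-elim (avoids (bottom-before-top⇒Contains2143 2≤t j+2<s bottom-first))

  TopBeforeBottom⇔condition :
    TopBeforeBottom ⇔ (∀ J → 3 ≤ J → J ≤ s → Before π (J * t) ((J ∸ 3) * t + 1))
  TopBeforeBottom⇔condition = mk⇔
    (λ { tbb (suc j) (s≤s 2≤j) j<s → subst (Before-bottom j) (cell-top t j) (tbb j 2≤j j<s) })
    (λ cond j 2≤j j<s → subst (Before-bottom j) (sym (cell-top t j)) (cond (suc j) (s≤s 2≤j) j<s))
    where
    Before-bottom : ℕ → ℕ → Set
    Before-bottom j a = Before π a (cell t (j ∸ 2) 0)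

theorem5p1 : (s t : ℕ) → 1 ≤ s → 2 ≤ t → (π : List ℕ) → IsLinExtEN s t π →
    Avoids2143 π ⇔ (∀ j → 3 ≤ j → j ≤ s → Before π (j * t) ((j ∸ 3) * t + 1))
theorem5p1 s t _ 2≤t π (perm , ext) = Equivalence.trans
  (mk⇔ (Avoids2143⇒TopBeforeBottom 2≤t) TopBeforeBottom⇒Avoids2143)
  TopBeforeBottom⇔condition
  where
  instance
    t≢0 : NonZero t
    t≢0 = >-nonZero (≤-trans (s≤s z≤n) 2≤t)
  open LinearExtension perm ext
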